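{- Let $k\ge 2$, $t=k+2$, and let $n$ be a positive multiple of $k$. Let $\mathcal T$ be a $k$-color valid triangulation of points $p_1,\ldots,p_{n+2}$ in convex position that contains a $t$-ear with ear-edge $p_rp_s$ for some $r\ge 1$ and $s=r+t-1\le n+2$. Then the triangulation $\mathcal T'$ obtained from $\mathcal T$ by removing the $t$-ear (deleting the points $p_{r+1},\ldots,p_{s-1}$ and all incident edges, and relabeling the remaining $n+2-k$ points clockwise starting from $p_1$) is again $k$-color valid.
   Context: A triangulation of points in convex position is a maximal plane straight-line graph on them. A $t$-ear of a triangulation $\mathcal T$ of $p_1,\ldots,p_{N+2}$ with ear-edge $p_rp_s$ ($s=r+t-1$) means that $p_rp_s$ is an edge of $\mathcal T$, so that $\mathcal T$ restricted to $p_r,\ldots,p_s$ is a triangulated $t$-gon that can be split off along $p_rp_s$. Outdegree sequence of a triangulation $\mathcal T$ of $p_1,\ldots,p_{N+2}$: for $1\le i\le N$, $d_i$ is the number of edges $p_ip_j$ of $\mathcal T$ with $j>i$ that are not convex hull edges, except that the hull edge $p_1p_{N+2}$ is counted (for $p_1$). From $(d_1,\ldots,d_N)$ form the $0/1$-sequence $(b_1,\ldots,b_{2N})$ by writing, for $i=1,\ldots,N$ in order, $d_i$ ones followed by one zero. On points $v_1,\ldots,v_{2N}$ in convex position (clockwise) build a matching by scanning $j=1,\ldots,2N$ with a stack: if $b_j=1$ push $j$; if $b_j=0$ pop the top index $\ell$ and add edge $v_\ell v_j$. This yields a plane perfect matching $M(\mathcal T)$. Coloring: for $N$ a multiple of $k$,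 the vertices are split into blocks $\{v_{(i-1)k+1},\ldots,v_{ik}\}$ and $v_{(i-1)k+r}$ ($1\le r\le k$) gets color $c_r$ if $i$ is odd and $c_{k+1-r}$ if $i$ is even. A triangulation $\mathcal T$ is $k$-color valid if every edge of $M(\mathcal T)$ joins two vertices of the same color. -}

module Defs where

open import Data.Nat using (ℕ; zero; suc; _+_; _∸_; _≤_; _<_; _≤ᵇ_; _≡ᵇ_)
open import Data.Nat.DivMod using (_/_; _%_)
open import Data.Bool using (Bool; true; false; _∧_; not; if_then_else_; T)
open import Data.List using (List; []; _∷_; _++_; map; concatMap; replicate; upTo)
open import Data.List.Relation.Unary.All using (All)
open import Data.Product using (_×_; _,_; ∃₂; proj₁; proj₂)
open import Data.Sum using (_⊎_)
open import Data.Empty using (⊥)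
open import Relation.Binary.PropositionalEquality using (_≡_)

-- Points p_1, ..., p_m in convex position are identified with indices 1..m.
-- A (candidate) set of diagonals is a Boolean relation E; only E i j with
-- i < j is ever consulted.
Graph : Set
Graph = ℕ → ℕ → Bool

isDiag : ℕ → ℕ → ℕ → Bool
isDiag m i j = (1 ≤ᵇ i) ∧ ((i + 2) ≤ᵇ j) ∧ (j ≤ᵇ m) ∧ not ((i ≡ᵇ 1) ∧ (j ≡ᵇ m))

inD : ℕ → Graph → ℕ → ℕ → Bool
inD m E i j = isDiag m i j ∧ E i j

Crossing : ℕ → ℕ → ℕ → ℕ → Set
Crossing a b c d = (a < c × c < b × b < d) ⊎ (c < a × a < d × d < b)

-- E together with all hull edges is a maximal plane straight-line graph
-- on p_1..p_m in convex position: diagonals pairwise non-crossing, and every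
-- diagonal not in E crosses some diagonal of E.
IsTriangulation : ℕ → Graph → Set
IsTriangulation m E =
  (∀ a b c d → T (inD m E a b) → T (inD m E c d) → Crossing a b c d → ⊥)
  × (∀ a b → T (isDiag m a b) → E a b ≡ false →
       ∃₂ λ c d → T (inD m E c d) × Crossing a b c d)

IsHullEdge : ℕ → ℕ → ℕ → Set
IsHullEdge m i j = (1 ≤ i × j ≡ suc i × j ≤ m) ⊎ (i ≡ 1 × j ≡ m)

IsEdge : ℕ → Graph → ℕ → ℕ → Set
IsEdge m E i j = IsHullEdge m i j ⊎ T (inD m E i j)

countTo : (ℕ → Bool) → ℕ → ℕ
countTo f zero = 0
countTo f (suc j) = countTo f j + (if f (suc j) then 1 else 0)

outdeg : ℕ → Graph → ℕ → ℕ
outdeg N E i = countTo (λ j → inD (N + 2) E i j) (N + 2) + (if i ≡ᵇ 1 then 1 else 0)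

outdegSeq : ℕ → Graph → List ℕ
outdegSeq N E = map (λ i → outdeg N E (suc i)) (upTo N)

bits : List ℕ → List Bool
bits = concatMap (λ d → replicate d true ++ (false ∷ []))

-- stack scan; first argument is the current position j.
-- (Popping an empty stack cannot happen for triangulations; we skip it.)
scan : ℕ → List ℕ → List Bool → List (ℕ × ℕ)
scan j st [] = []
scan j st (true ∷ bs) = scan (suc j) (j ∷ st) bs
scan j (l ∷ st) (false ∷ bs) = (l , j) ∷ scan (suc j) st bs
scan j [] (false ∷ bs) = scan (suc j) [] bs

-- the plane perfect matching M(T) on v_1..v_{2N}, as pairs of indices
matching : ℕ → Graph → List (ℕ × ℕ)
matching N E = scan 1 [] (bits (outdegSeq N E))

-- colour of v_j: index r-1 of c_r (colours c_1..c_k are distinct)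
isEven : ℕ → Bool
isEven zero = true
isEven (suc zero) = false
isEven (suc (suc n)) = isEven n

colour : ℕ → ℕ → ℕ
colour zero j = 0
colour (suc k′) j =
  if isEven ((j ∸ 1) / suc k′)
  then (j ∸ 1) % suc k′
  else k′ ∸ ((j ∸ 1) % suc k′)

KColorValid : ℕ → ℕ → Graph → Set
KColorValid k N E = All (λ e → colour k (proj₁ e) ≡ colour k (proj₂ e)) (matching N E)

removeEar : ℕ → ℕ → Graph → Graph
removeEar k r E i j = E (shift i) (shift j)
  where
  shift : ℕ → ℕ
  shift x = if x ≤ᵇ r then x else x + k

-- The chords inside the ear form a triangulated (k+2)-gon, and cutting such a polygon at the
-- apex over its base shows that its own outdegrees spell a Dyck word D of length 2k. Removing
-- the ear leaves the outdegrees left of the ear unchanged, shifts those right of it by k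
-- positions, and lowers the outdegree of p_r by its chords ending at p_(r+2), …, p_(r+k+1);
-- so the bit string of 𝒯′ is that of 𝒯 with the contiguous block D deleted. The stack scan
-- pushes and pops D entirely by itself, after which it continues 2k positions later with the
-- same stack; as the colouring has period 2k, every matching edge of 𝒯′ is coloured like a
-- matching edge of 𝒯.

module Submission where

open import Defs
open import Data.Nat using (ℕ; zero; suc; _+_; _∸_; _*_; _≤_; _<_; s≤s; z≤n; _≤ᵇ_; _≡ᵇ_; _≤?_; >-nonZero)
open import Data.Nat.Properties
open import Data.Nat.DivMod using (_/_; _%_; +-distrib-/-∣ʳ; m*n/n≡m; [m+kn]%n≡m%n)
open import Data.Nat.Divisibility using (_∣_; divides-refl; ∣⇒≤)
open import Data.Nat.Induction using (<-wellFounded)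
open import Data.Nat.Tactic.RingSolver using (solve-∀)
open import Data.Bool using (Bool; true; false; if_then_else_; _∧_; not; T)
open import Data.Bool.Properties using (T-∧; T-≡; T-not-≡)
open import Data.List using (List; []; _∷_; _++_; length; replicate; applyUpTo)
open import Data.List.Properties using (++-assoc; length-++; ∷ʳ-injectiveˡ; ++-identityʳ; map-upTo)
open import Data.List.Relation.Unary.All using (All; []; _∷_)
open import Data.List.Relation.Unary.All.Properties using (++⁺; ++⁻)
open import Data.List.Relation.Binary.Pointwise using (Pointwise; []; _∷_)
import Data.List.Relation.Binary.Pointwise.Properties as Pointwise
open import Data.Product using (_×_; _,_; ∃; ∃₂; proj₁; proj₂)
open import Data.Sum using (_⊎_; inj₁; inj₂)
open import Data.Empty using (⊥; ⊥-elim)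
open import Data.Unit using (tt)
open import Function.Base using (case_of_)
open import Function.Bundles using (module Equivalence)
open import Induction.WellFounded using (Acc; acc)
open import Relation.Nullary using (¬_; yes; no)
open import Relation.Binary using (tri<; tri≈; tri>)
open import Relation.Binary.PropositionalEquality

open Equivalence using (to; from)

isEven-+2 : ∀ q → isEven (q + 2) ≡ isEven q
isEven-+2 zero = refl
isEven-+2 (suc zero) = refl
isEven-+2 (suc (suc q)) = isEven-+2 q

colour-periodic : ∀ k t → colour k (suc t + (k + k)) ≡ colour k (suc t)
colour-periodic zero t = refl
colour-periodic (suc k′) t =
  cong₂ (λ q ρ → if q then ρ else k′ ∸ ρ) (trans (cong isEven quotient) (isEven-+2 (t / k))) remainder
  where
  k : ℕ
  k = suc k′
  k+k≡2*k : k + k ≡ 2 * k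
  k+k≡2*k = cong (k +_) (sym (+-identityʳ k))
  quotient : (t + (k + k)) / k ≡ t / k + 2
  quotient = begin
    (t + (k + k)) / k   ≡⟨ cong (λ z → (t + z) / k) k+k≡2*k ⟩
    (t + 2 * k) / k     ≡⟨ +-distrib-/-∣ʳ t (divides-refl 2) ⟩
    t / k + 2 * k / k   ≡⟨ cong (t / k +_) (m*n/n≡m 2 k) ⟩
    t / k + 2           ∎
    where open ≡-Reasoning
  remainder : (t + (k + k)) % k ≡ t % k
  remainder = trans (cong (λ z → (t + z) % k) k+k≡2*k) ([m+kn]%n≡m%n t 2 k)

data Balanced : List Bool → Set where
  empty : Balanced []
  nest  : ∀ {D₁ D₂} → Balanced D₁ → Balanced D₂ → Balanced (true ∷ D₁ ++ false ∷ D₂)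

scan-++ : ∀ U j st → ∃₂ λ A st′ → ∀ W → scan j st (U ++ W) ≡ A ++ scan (j + length U) st′ W
scan-++ [] j st = [] , st , λ W → cong (λ z → scan z st W) (sym (+-identityʳ j))
scan-++ (true ∷ U) j st with scan-++ U (suc j) (j ∷ st)
... | A , st′ , eq = A , st′ , λ W → trans (eq W) (cong (λ z → A ++ scan z st′ W) (sym (+-suc j (length U))))
scan-++ (false ∷ U) j (l ∷ st) with scan-++ U (suc j) st
... | A , st′ , eq = (l , j) ∷ A , st′ , λ W →
  cong ((l , j) ∷_) (trans (eq W) (cong (λ z → A ++ scan z st′ W) (sym (+-suc j (length U)))))
scan-++ (false ∷ U) j [] with scan-++ U (suc j) []
... | A , st′ , eq = A , st′ , λ W → trans (eq W) (cong (λ z → A ++ scan z st′ W) (sym (+-suc j (length U))))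

scan-++-balanced : ∀ {D} → Balanced D → ∀ j st V →
                   ∃ λ M → scan j st (D ++ V) ≡ M ++ scan (j + length D) st V
scan-++-balanced empty j st V = [] , cong (λ z → scan z st V) (sym (+-identityʳ j))
scan-++-balanced (nest {D₁} {D₂} b₁ b₂) j st V
  with scan-++-balanced b₁ (suc j) (j ∷ st) (false ∷ D₂ ++ V)
     | scan-++-balanced b₂ (suc (suc j + length D₁)) st V
... | M₁ , eq₁ | M₂ , eq₂ = M₁ ++ (j , close) ∷ M₂ , (begin
    scan (suc j) (j ∷ st) ((D₁ ++ false ∷ D₂) ++ V)        ≡⟨ cong (scan (suc j) (j ∷ st)) (++-assoc D₁ (false ∷ D₂) V) ⟩
    scan (suc j) (j ∷ st) (D₁ ++ false ∷ D₂ ++ V)          ≡⟨ eq₁ ⟩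
    M₁ ++ (j , close) ∷ scan (suc close) st (D₂ ++ V)      ≡⟨ cong (λ z → M₁ ++ (j , close) ∷ z) eq₂ ⟩
    M₁ ++ (j , close) ∷ M₂ ++ scan (suc close + length D₂) st V
      ≡⟨ cong (λ z → M₁ ++ (j , close) ∷ M₂ ++ scan z st V) position ⟩
    M₁ ++ (j , close) ∷ M₂ ++ scan (j + length D) st V     ≡⟨ sym (++-assoc M₁ _ _) ⟩
    (M₁ ++ (j , close) ∷ M₂) ++ scan (j + length D) st V   ∎)
  where
  open ≡-Reasoning
  D : List Bool
  D = true ∷ D₁ ++ false ∷ D₂
  close : ℕ
  close = suc j + length D₁
  arith : ∀ j a b → suc (suc j + a) + b ≡ j + suc (a + suc b)
  arith = solve-∀
  position : suc close + length D₂ ≡ j + length D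
  position = trans (arith j (length D₁) (length D₂)) (cong (λ z → j + suc z) (sym (length-++ D₁)))

module Colouring (k : ℕ) where

  SameColour : ℕ → ℕ → Set
  SameColour a b = colour k a ≡ colour k b

  Monochromatic : ℕ × ℕ → Set
  Monochromatic e = SameColour (proj₁ e) (proj₂ e)

  private
    here : ∀ {j₁ j₂} → (∀ i → SameColour (j₁ + i) (j₂ + i)) → SameColour j₁ j₂
    here h = subst₂ SameColour (+-identityʳ _) (+-identityʳ _) (h 0)

    next : ∀ {j₁ j₂} → (∀ i → SameColour (j₁ + i) (j₂ + i)) → ∀ i → SameColour (suc j₁ + i) (suc j₂ + i)
    next h i = subst₂ SameColour (+-suc _ i) (+-suc _ i) (h (suc i))

  scan-respects-colour : ∀ V {j₁ j₂ st₁ st₂} → Pointwise SameColour st₁ st₂ →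
                         (∀ i → SameColour (j₁ + i) (j₂ + i)) →
                         All Monochromatic (scan j₂ st₂ V) → All Monochromatic (scan j₁ st₁ V)
  scan-respects-colour [] _ _ _ = []
  scan-respects-colour (true ∷ V) ps h ms = scan-respects-colour V (here h ∷ ps) (next h) ms
  scan-respects-colour (false ∷ V) (p ∷ ps) h (m ∷ ms) =
    trans p (trans m (sym (here h))) ∷ scan-respects-colour V ps (next h) ms
  scan-respects-colour (false ∷ V) [] h ms = scan-respects-colour V [] (next h) ms

  scan-drop-balanced : ∀ U {D} V → Balanced D → length D ≡ k + k →
                       All Monochromatic (scan 1 [] (U ++ D ++ V)) → All Monochromatic (scan 1 [] (U ++ V))
  scan-drop-balanced U {D} V bal len valid with scan-++ U 1 []
  ... | A , st , eqU with scan-++-balanced bal (1 + length U) st V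
  ... | M , eqD with ++⁻ A (subst (All Monochromatic) (trans (eqU (D ++ V)) (cong (A ++_) eqD)) valid)
  ... | validA , validRest =
    subst (All Monochromatic) (sym (eqU V))
      (++⁺ validA (scan-respects-colour V (Pointwise.refl refl) shifted (proj₂ (++⁻ M validRest))))
    where
    u : ℕ
    u = length U
    arith : ∀ u i l → suc u + l + i ≡ suc (u + i) + l
    arith = solve-∀
    shifted : ∀ i → SameColour (1 + u + i) (1 + u + length D + i)
    shifted i = sym (begin
      colour k (suc u + length D + i)  ≡⟨ cong (λ l → colour k (suc u + l + i)) len ⟩
      colour k (suc u + (k + k) + i)   ≡⟨ cong (colour k) (arith u i (k + k)) ⟩
      colour k (suc (u + i) + (k + k)) ≡⟨ colour-periodic k (u + i) ⟩
      colour k (suc u + i)             ∎)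
      where open ≡-Reasoning

countTo-+ : ∀ f a b → countTo f (a + b) ≡ countTo f a + countTo (λ j → f (a + j)) b
countTo-+ f a zero = trans (cong (countTo f) (+-identityʳ a)) (sym (+-identityʳ _))
countTo-+ f a (suc b) = begin
  countTo f (a + suc b)                                                       ≡⟨ cong (countTo f) (+-suc a b) ⟩
  countTo f (a + b) + indicator (f (suc (a + b)))
    ≡⟨ cong₂ _+_ (countTo-+ f a b) (cong (λ z → indicator (f z)) (sym (+-suc a b))) ⟩
  countTo f a + countTo (λ j → f (a + j)) b + indicator (f (a + suc b))       ≡⟨ +-assoc (countTo f a) _ _ ⟩
  countTo f a + countTo (λ j → f (a + j)) (suc b)                             ∎
  where
  open ≡-Reasoning
  indicator : Bool → ℕ
  indicator b = if b then 1 else 0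

countTo-cong : ∀ {f h} n → (∀ j → 1 ≤ j → j ≤ n → f j ≡ h j) → countTo f n ≡ countTo h n
countTo-cong zero eq = refl
countTo-cong (suc n) eq =
  cong₂ _+_ (countTo-cong n (λ j p q → eq j p (m≤n⇒m≤1+n q))) (cong (λ b → if b then 1 else 0) (eq (suc n) (s≤s z≤n) ≤-refl))

countTo-zero : ∀ {f} n → (∀ j → 1 ≤ j → j ≤ n → f j ≡ false) → countTo f n ≡ 0
countTo-zero zero eq = refl
countTo-zero (suc n) eq =
  cong₂ _+_ (countTo-zero n (λ j p q → eq j p (m≤n⇒m≤1+n q))) (cong (λ b → if b then 1 else 0) (eq (suc n) (s≤s z≤n) ≤-refl))

skip : ℕ → ℕ → ℕ → ℕ
skip a k x = if x ≤ᵇ a then x else x + k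

skip-≤ : ∀ {a} k {x} → x ≤ a → skip a k x ≡ x
skip-≤ {a} k {x} x≤a = cong (λ b → if b then x else x + k) (to T-≡ (≤⇒≤ᵇ x≤a))

skip-> : ∀ {a} k {x} → a < x → skip a k x ≡ x + k
skip-> {a} k {x} a<x with x ≤ᵇ a in eq
... | false = refl
... | true = ⊥-elim (<⇒≱ a<x (≤ᵇ⇒≤ x a (from T-≡ eq)))

countTo-skip : ∀ f a k b → (∀ j → 1 ≤ j → j ≤ k → f (a + j) ≡ false) →
               countTo (λ j → f (skip a k j)) (a + b) ≡ countTo f (a + k + b)
countTo-skip f a k b gap = begin
  countTo (λ j → f (skip a k j)) (a + b)                                    ≡⟨ countTo-+ _ a b ⟩
  countTo (λ j → f (skip a k j)) a + countTo (λ j → f (skip a k (a + j))) b ≡⟨ cong₂ _+_ below above ⟩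
  countTo f a + countTo (λ j → f (a + k + j)) b                             ≡⟨ cong (_+ countTo (λ j → f (a + k + j)) b) gapless ⟩
  countTo f (a + k) + countTo (λ j → f (a + k + j)) b                       ≡⟨ sym (countTo-+ f (a + k) b) ⟩
  countTo f (a + k + b)                                                     ∎
  where
  open ≡-Reasoning
  below : countTo (λ j → f (skip a k j)) a ≡ countTo f a
  below = countTo-cong a (λ j _ j≤a → cong f (skip-≤ k j≤a))
  arith : ∀ a j k → a + j + k ≡ a + k + j
  arith = solve-∀
  above : countTo (λ j → f (skip a k (a + j))) b ≡ countTo (λ j → f (a + k + j)) b
  above = countTo-cong b (λ j 1≤j _ → cong f (trans (skip-> k (m<m+n a 1≤j)) (arith a j k)))
  gapless : countTo f a ≡ countTo f (a + k)
  gapless = sym (trans (countTo-+ f a k) (trans (cong (countTo f a +_) (countTo-zero k gap)) (+-identityʳ _)))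

segment : (ℕ → ℕ) → ℕ → ℕ → List ℕ
segment f a zero = []
segment f a (suc l) = f a ∷ segment f (suc a) l

segment-+ : ∀ f a l₁ l₂ → segment f a (l₁ + l₂) ≡ segment f a l₁ ++ segment f (a + l₁) l₂
segment-+ f a zero l₂ = cong (λ z → segment f z l₂) (sym (+-identityʳ a))
segment-+ f a (suc l₁) l₂ =
  cong (f a ∷_) (trans (segment-+ f (suc a) l₁ l₂) (cong (λ z → segment f (suc a) l₁ ++ segment f z l₂) (sym (+-suc a l₁))))

segment-cong : ∀ {f h} a l → (∀ i → a ≤ i → i < a + l → f i ≡ h i) → segment f a l ≡ segment h a l
segment-cong a zero eq = refl
segment-cong a (suc l) eq =
  cong₂ _∷_ (eq a ≤-refl (m<m+n a (s≤s z≤n)))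
            (segment-cong (suc a) l (λ i a<i i<a+l → eq i (<⇒≤ a<i) (subst (i <_) (sym (+-suc a l)) i<a+l)))

segment-shift : ∀ f k a l → segment (λ i → f (i + k)) a l ≡ segment f (a + k) l
segment-shift f k a zero = refl
segment-shift f k a (suc l) = cong (f (a + k) ∷_) (segment-shift f k (suc a) l)

applyUpTo-segment : ∀ q f a n → (∀ i → q i ≡ f (a + i)) → applyUpTo q n ≡ segment f a n
applyUpTo-segment q f a zero eq = refl
applyUpTo-segment q f a (suc n) eq =
  cong₂ _∷_ (trans (eq 0) (cong f (+-identityʳ a)))
            (applyUpTo-segment (λ i → q (suc i)) f (suc a) n (λ i → trans (eq (suc i)) (cong f (+-suc a i))))

outdegSeq-segment : ∀ N E → outdegSeq N E ≡ segment (outdeg N E) 1 N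
outdegSeq-segment N E = trans (map-upTo _ N) (applyUpTo-segment _ (outdeg N E) 1 N (λ i → refl))

bits-++ : ∀ xs ys → bits (xs ++ ys) ≡ bits xs ++ bits ys
bits-++ [] ys = refl
bits-++ (x ∷ xs) ys =
  trans (cong ((replicate x true ++ false ∷ []) ++_) (bits-++ xs ys))
        (sym (++-assoc (replicate x true ++ false ∷ []) (bits xs) (bits ys)))

bits-+ : ∀ x y xs → bits ((x + y) ∷ xs) ≡ replicate x true ++ bits (y ∷ xs)
bits-+ zero y xs = refl
bits-+ (suc x) y xs = cong (true ∷_) (bits-+ x y xs)

T-extensional : ∀ {b₁ b₂} → (T b₁ → T b₂) → (T b₂ → T b₁) → b₁ ≡ b₂
T-extensional {false} {false} _ _ = refl
T-extensional {false} {true}  _ g = ⊥-elim (g tt)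
T-extensional {true}  {false} f _ = ⊥-elim (f tt)
T-extensional {true}  {true}  _ _ = refl

¬T⇒≡false : ∀ {b} → ¬ T b → b ≡ false
¬T⇒≡false {false} _ = refl
¬T⇒≡false {true} ¬t = ⊥-elim (¬t tt)

not-T : ∀ {b} → T (not b) → ¬ T b
not-T {false} _ ()

Diagonal : ℕ → ℕ → ℕ → Set
Diagonal m i j = 1 ≤ i × i + 2 ≤ j × j ≤ m × ¬ (i ≡ 1 × j ≡ m)

isDiag⇒Diagonal : ∀ m i j → T (isDiag m i j) → Diagonal m i j
isDiag⇒Diagonal m i j t with to T-∧ t
... | t₁ , t′ with to T-∧ t′
... | t₂ , t″ with to T-∧ t″
... | t₃ , t₄ = ≤ᵇ⇒≤ 1 i t₁ , ≤ᵇ⇒≤ (i + 2) j t₂ , ≤ᵇ⇒≤ j m t₃ ,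
  λ (i≡1 , j≡m) → not-T t₄ (from T-∧ (≡⇒≡ᵇ i 1 i≡1 , ≡⇒≡ᵇ j m j≡m))

Diagonal⇒isDiag : ∀ m i j → Diagonal m i j → T (isDiag m i j)
Diagonal⇒isDiag m i j (1≤i , i+2≤j , j≤m , notHull) =
  from T-∧ (≤⇒≤ᵇ 1≤i , from T-∧ (≤⇒≤ᵇ i+2≤j , from T-∧ (≤⇒≤ᵇ j≤m ,
    from T-not-≡ (¬T⇒≡false λ t → notHull (≡ᵇ⇒≡ i 1 (proj₁ (to T-∧ t)) , ≡ᵇ⇒≡ j m (proj₂ (to T-∧ t)))))))

isDiag-short : ∀ m i j → j ≤ suc i → isDiag m i j ≡ false
isDiag-short m i j j≤1+i = T-extensional
  (λ t → <-irrefl refl (≤-trans (subst (_≤ j) (+-comm i 2) (proj₁ (proj₂ (isDiag⇒Diagonal m i j t)))) j≤1+i))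
  (λ ())

inD-short : ∀ m E i j → j ≤ suc i → inD m E i j ≡ false
inD-short m E i j j≤1+i = cong (_∧ E i j) (isDiag-short m i j j≤1+i)

module _ {m m′ k : ℕ} (m≡m′+k : m ≡ m′ + k) where

  isDiag-below : ∀ i j → j < m′ → isDiag m′ i j ≡ isDiag m i j
  isDiag-below i j j<m′ = T-extensional
    (λ t → let (1≤i , i+2≤j , j≤m′ , _) = isDiag⇒Diagonal m′ i j t in
      Diagonal⇒isDiag m i j (1≤i , i+2≤j , ≤-trans j≤m′ m′≤m ,
        λ (_ , j≡m) → <⇒≱ j<m′ (subst (m′ ≤_) (sym j≡m) m′≤m)))
    (λ t → let (1≤i , i+2≤j , _ , _) = isDiag⇒Diagonal m i j t in
      Diagonal⇒isDiag m′ i j (1≤i , i+2≤j , <⇒≤ j<m′ , λ (_ , j≡m′) → <-irrefl j≡m′ j<m′))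
    where
    m′≤m : m′ ≤ m
    m′≤m = subst (m′ ≤_) (sym m≡m′+k) (m≤m+n m′ k)

  isDiag-stretch : ∀ i j → i + 2 ≤ j → isDiag m′ i j ≡ isDiag m i (j + k)
  isDiag-stretch i j i+2≤j = T-extensional
    (λ t → let (1≤i , _ , j≤m′ , notHull) = isDiag⇒Diagonal m′ i j t in
      Diagonal⇒isDiag m i (j + k) (1≤i , ≤-trans i+2≤j (m≤m+n j k) , subst (j + k ≤_) (sym m≡m′+k) (+-monoˡ-≤ k j≤m′) ,
        λ (i≡1 , j+k≡m) → notHull (i≡1 , +-cancelʳ-≡ k j m′ (trans j+k≡m m≡m′+k))))
    (λ t → let (1≤i , _ , j+k≤m , notHull) = isDiag⇒Diagonal m i (j + k) t in
      Diagonal⇒isDiag m′ i j (1≤i , i+2≤j , +-cancelʳ-≤ k j m′ (subst (j + k ≤_) m≡m′+k j+k≤m) ,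
        λ (i≡1 , j≡m′) → notHull (i≡1 , trans (cong (_+ k) j≡m′) (sym m≡m′+k))))

  isDiag-shift : ∀ i j → 2 ≤ i → isDiag m′ i j ≡ isDiag m (i + k) (j + k)
  isDiag-shift i j 2≤i = T-extensional
    (λ t → let (_ , i+2≤j , j≤m′ , _) = isDiag⇒Diagonal m′ i j t in
      Diagonal⇒isDiag m (i + k) (j + k) (≤-trans 1≤i (m≤m+n i k) , subst (_≤ j + k) (arith i k) (+-monoˡ-≤ k i+2≤j) ,
        subst (j + k ≤_) (sym m≡m′+k) (+-monoˡ-≤ k j≤m′) , λ (i+k≡1 , _) → not1 (i + k) (≤-trans 2≤i (m≤m+n i k)) i+k≡1))
    (λ t → let (_ , i+k+2≤j+k , j+k≤m , _) = isDiag⇒Diagonal m (i + k) (j + k) t in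
      Diagonal⇒isDiag m′ i j (1≤i , +-cancelʳ-≤ k (i + 2) j (subst (_≤ j + k) (sym (arith i k)) i+k+2≤j+k) ,
        +-cancelʳ-≤ k j m′ (subst (j + k ≤_) m≡m′+k j+k≤m) , λ (i≡1 , _) → not1 i 2≤i i≡1))
    where
    1≤i : 1 ≤ i
    1≤i = ≤-trans (s≤s z≤n) 2≤i
    arith : ∀ i k → i + 2 + k ≡ i + k + 2
    arith = solve-∀
    not1 : ∀ x → 2 ≤ x → ¬ x ≡ 1
    not1 x 2≤x x≡1 = <-irrefl (sym x≡1) 2≤x

<⇒∃suc : ∀ {a b} → a < b → ∃ λ l → b ≡ a + suc l
<⇒∃suc {a} a<b with m≤n⇒∃[o]m+o≡n a<b
... | l , a+1+l≡b = l , trans (sym a+1+l≡b) (sym (+-suc a l))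

module Triangulated {m : ℕ} {E : Graph} (tri : IsTriangulation m E) where

  Chord : ℕ → ℕ → Set
  Chord i j = T (inD m E i j)

  Edge : ℕ → ℕ → Set
  Edge i j = j ≡ suc i ⊎ Chord i j

  nonCrossing : ∀ a b c d → Chord a b → Chord c d → Crossing a b c d → ⊥
  nonCrossing = proj₁ tri

  chord-diagonal : ∀ {i j} → Chord i j → Diagonal m i j
  chord-diagonal {i} {j} ij = isDiag⇒Diagonal m i j (proj₁ (to T-∧ ij))

  lastNeighbour : ∀ a d → ∃ λ c → a < c × c ≤ a + suc d × Edge a c ×
                                  (∀ c′ → c < c′ → c′ ≤ a + suc d → ¬ Edge a c′)
  lastNeighbour a zero = a + 1 , m<m+n a (s≤s z≤n) , ≤-refl , inj₁ (+-comm a 1) ,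
    λ c′ c<c′ c′≤c _ → <⇒≱ c<c′ c′≤c
  lastNeighbour a (suc d) with inD m E a (a + suc (suc d)) in eq
  ... | true = a + suc (suc d) , m<m+n a (s≤s z≤n) , ≤-refl , inj₂ (from T-≡ eq) ,
    λ c′ c<c′ c′≤c _ → <⇒≱ c<c′ c′≤c
  ... | false with lastNeighbour a d
  ... | c , a<c , c≤ , ac , noLater = c , a<c , ≤-trans c≤ (+-monoʳ-≤ a (n≤1+n _)) , ac , noLater′
    where
    noLater′ : ∀ c′ → c < c′ → c′ ≤ a + suc (suc d) → ¬ Edge a c′
    noLater′ c′ c<c′ c′≤ ac′ with m≤n⇒m<n∨m≡n c′≤
    ... | inj₁ c′< = noLater c′ c<c′ (≤-pred (subst (suc c′ ≤_) (+-suc a (suc d)) c′<)) ac′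
    noLater′ c′ c<c′ c′≤ (inj₁ c′≡1+a) | inj₂ refl =
      <-irrefl (sym (trans c′≡1+a (sym (+-comm a 1)))) (+-monoʳ-< a (s≤s (s≤s z≤n)))
    noLater′ c′ c<c′ c′≤ (inj₂ ac′) | inj₂ refl with () ← trans (sym eq) (to T-≡ ac′)

  -- the apex of the triangle on a chord ab, on the side of a..b, is a's last neighbour before b
  apex : ∀ a b → Chord a b → ∃ λ c → a < c × c < b × Edge a c × Edge c b
  apex a b ab with chord-diagonal ab
  ... | 1≤a , a+2≤b , b≤m , _ with <⇒∃suc (subst (_≤ b) (+-comm a 2) a+2≤b)
  ... | d , refl with lastNeighbour a d
  ... | c , a<c , c≤ , ac , noLater = c , a<c , s≤s c≤ , ac , cb
    where
    cb-diagonal : suc c < b → Diagonal m c b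
    cb-diagonal c+1<b = ≤-trans 1≤a (<⇒≤ a<c) , subst (_≤ b) (+-comm 2 c) c+1<b , b≤m ,
      λ (c≡1 , _) → <⇒≱ (≤-trans (s≤s 1≤a) a<c) (≤-reflexive c≡1)
    no-crossing : ∀ p q → Chord p q → ¬ Crossing c b p q
    no-crossing p q pq (inj₁ (c<p , p<b , b<q)) = nonCrossing a b p q ab pq (inj₁ (<-trans a<c c<p , p<b , b<q))
    no-crossing p q pq (inj₂ (p<c , c<q , q<b)) with <-cmp p a
    ... | tri< p<a _ _ = nonCrossing a b p q ab pq (inj₂ (p<a , <-trans a<c c<q , q<b))
    ... | tri≈ _ refl _ = noLater q c<q (≤-pred q<b) (inj₂ pq)
    ... | tri> _ _ a<p = inside ac
      where
      inside : Edge a c → ⊥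
      inside (inj₁ c≡1+a) = <⇒≱ (subst (p <_) c≡1+a p<c) a<p
      inside (inj₂ ac′) = nonCrossing a c p q ac′ pq (inj₁ (a<p , p<c , c<q))
    cb : Edge c b
    cb with m≤n⇒m<n∨m≡n (s≤s c≤)
    ... | inj₂ c+1≡b = inj₁ (sym c+1≡b)
    ... | inj₁ c+1<b with E c b in eq
    ...   | true = inj₂ (from T-∧ (Diagonal⇒isDiag m c b (cb-diagonal c+1<b) , tt))
    ...   | false with proj₂ tri c b (Diagonal⇒isDiag m c b (cb-diagonal c+1<b)) eq
    ...     | p , q , pq , crossing = ⊥-elim (no-crossing p q pq crossing)

  outdegUpTo : ℕ → ℕ → ℕ
  outdegUpTo b i = countTo (inD m E i) b

  outdegUpTo-+ : ∀ i b t → (∀ j → 1 ≤ j → j ≤ t → ¬ Chord i (b + j)) → outdegUpTo (b + t) i ≡ outdegUpTo b i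
  outdegUpTo-+ i b t none = begin
    outdegUpTo (b + t) i                                    ≡⟨ countTo-+ (inD m E i) b t ⟩
    outdegUpTo b i + countTo (λ j → inD m E i (b + j)) t
      ≡⟨ cong (outdegUpTo b i +_) (countTo-zero t (λ j 1≤j j≤t → ¬T⇒≡false (none j 1≤j j≤t))) ⟩
    outdegUpTo b i + 0                                      ≡⟨ +-identityʳ _ ⟩
    outdegUpTo b i                                          ∎
    where open ≡-Reasoning

  -- the bit sequence of the triangulated (l+2)-gon a, a+1, …, b = a+l+1 cut off by the chord ab
  DyckEncoding : ℕ → ℕ → ℕ → Set
  DyckEncoding l a b =
    ∃ λ D → Balanced D × length D ≡ l + l × bits (segment (outdegUpTo b) a (suc l)) ≡ D ++ false ∷ []

  module _ (a l₁ l₂ : ℕ) where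
    private
      c b : ℕ
      c = a + suc l₁
      b = c + suc l₂

    outdegUpTo-base : Edge c b → Chord a b → outdegUpTo b a ≡ suc (outdegUpTo c a)
    outdegUpTo-base cb ab = begin
      outdegUpTo (c + suc l₂) a                                      ≡⟨ cong (λ t → outdegUpTo t a) (+-suc c l₂) ⟩
      outdegUpTo (c + l₂) a + (if inD m E a (suc (c + l₂)) then 1 else 0)
        ≡⟨ cong₂ (λ x y → x + (if y then 1 else 0)) (outdegUpTo-+ a c l₂ none) (trans (cong (inD m E a) (sym (+-suc c l₂))) (to T-≡ ab)) ⟩
      outdegUpTo c a + 1                                             ≡⟨ +-comm _ 1 ⟩
      suc (outdegUpTo c a)                                           ∎
      where
      open ≡-Reasoning
      a<c : a < c
      a<c = m<m+n a (s≤s z≤n)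
      none : ∀ j → 1 ≤ j → j ≤ l₂ → ¬ Chord a (c + j)
      none j 1≤j j≤l₂ a-cj = across cb
        where
        across : Edge c b → ⊥
        across (inj₁ b≡1+c) =
          <⇒≱ (≤-trans 1≤j j≤l₂) (≤-reflexive (suc-injective (+-cancelˡ-≡ c (suc l₂) 1 (trans b≡1+c (sym (+-comm c 1))))))
        across (inj₂ cb′) = nonCrossing a (c + j) c b a-cj cb′ (inj₁ (a<c , m<m+n c 1≤j , +-monoʳ-< c (s≤s j≤l₂)))

    outdegUpTo-inner : Edge a c → ∀ i → a < i → i < c → outdegUpTo b i ≡ outdegUpTo c i
    outdegUpTo-inner ac i a<i i<c = outdegUpTo-+ i c (suc l₂) none
      where
      none : ∀ j → 1 ≤ j → j ≤ suc l₂ → ¬ Chord i (c + j)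
      none j 1≤j _ i-cj = across ac
        where
        across : Edge a c → ⊥
        across (inj₁ c≡1+a) = <⇒≱ (subst (i <_) c≡1+a i<c) a<i
        across (inj₂ ac′) = nonCrossing a c i (c + j) ac′ i-cj (inj₁ (a<i , i<c , m<m+n c 1≤j))

    dyckEncoding-glue : Edge a c → Edge c b → Chord a b →
                        DyckEncoding l₁ a c → DyckEncoding l₂ c b → DyckEncoding (l₁ + suc l₂) a b
    dyckEncoding-glue ac cb ab (D₁ , bal₁ , len₁ , enc₁) (D₂ , bal₂ , len₂ , enc₂) =
      true ∷ D₁ ++ false ∷ D₂ , nest bal₁ bal₂ , length-ok , encoding
      where
      open ≡-Reasoning
      arith : ∀ l₁ l₂ → suc (l₁ + l₁ + suc (l₂ + l₂)) ≡ (l₁ + suc l₂) + (l₁ + suc l₂)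
      arith = solve-∀
      length-ok : length (true ∷ D₁ ++ false ∷ D₂) ≡ (l₁ + suc l₂) + (l₁ + suc l₂)
      length-ok = trans (cong suc (length-++ D₁)) (trans (cong₂ (λ x y → suc (x + suc y)) len₁ len₂) (arith l₁ l₂))
      inner : ∀ i → suc a ≤ i → i < suc a + l₁ → outdegUpTo b i ≡ outdegUpTo c i
      inner i a<i i< = outdegUpTo-inner ac i a<i (subst (i <_) (sym (+-suc a l₁)) i<)
      encoding : bits (segment (outdegUpTo b) a (suc (l₁ + suc l₂))) ≡ (true ∷ D₁ ++ false ∷ D₂) ++ false ∷ []
      encoding = begin
        bits (outdegUpTo b a ∷ segment (outdegUpTo b) (suc a) (l₁ + suc l₂))
          ≡⟨ cong₂ (λ x y → bits (x ∷ y)) (outdegUpTo-base cb ab) (segment-+ _ (suc a) l₁ (suc l₂)) ⟩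
        bits (suc (outdegUpTo c a) ∷ segment (outdegUpTo b) (suc a) l₁ ++ segment (outdegUpTo b) (suc a + l₁) (suc l₂))
          ≡⟨ cong₂ (λ x y → bits (suc (outdegUpTo c a) ∷ x ++ segment (outdegUpTo b) y (suc l₂)))
                   (segment-cong (suc a) l₁ inner) (sym (+-suc a l₁)) ⟩
        true ∷ bits (segment (outdegUpTo c) a (suc l₁) ++ segment (outdegUpTo b) c (suc l₂))
          ≡⟨ cong (true ∷_) (bits-++ (segment (outdegUpTo c) a (suc l₁)) _) ⟩
        true ∷ (bits (segment (outdegUpTo c) a (suc l₁)) ++ bits (segment (outdegUpTo b) c (suc l₂)))
          ≡⟨ cong₂ (λ x y → true ∷ (x ++ y)) enc₁ enc₂ ⟩
        true ∷ ((D₁ ++ false ∷ []) ++ D₂ ++ false ∷ [])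
          ≡⟨ cong (true ∷_) (trans (++-assoc D₁ (false ∷ []) (D₂ ++ false ∷ [])) (sym (++-assoc D₁ (false ∷ D₂) (false ∷ [])))) ⟩
        (true ∷ D₁ ++ false ∷ D₂) ++ false ∷ []
          ∎

  dyckEncoding : ∀ l a b → Acc _<_ l → b ≡ a + suc l → Edge a b → DyckEncoding l a b
  dyckEncoding zero a b _ refl _ =
    [] , empty , refl , cong (λ d → bits (d ∷ [])) (countTo-zero (a + 1) (λ j _ j≤ → inD-short m E a j (subst (j ≤_) (+-comm a 1) j≤)))
  dyckEncoding (suc l) a b _ b≡ (inj₁ b≡1+a)
    with () ← suc-injective (+-cancelˡ-≡ a (suc (suc l)) 1 (trans (sym b≡) (trans b≡1+a (sym (+-comm a 1)))))
  dyckEncoding (suc l) a b (acc rs) b≡ (inj₂ ab) with apex a b ab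
  ... | c , a<c , c<b , ac , cb with <⇒∃suc a<c | <⇒∃suc c<b
  ... | l₁ , refl | l₂ , refl =
    subst (λ L → DyckEncoding L a b) (sym size)
      (dyckEncoding-glue a l₁ l₂ ac cb ab (dyckEncoding l₁ a c (rs l₁<) refl ac) (dyckEncoding l₂ c b (rs l₂<) refl cb))
    where
    size : suc l ≡ l₁ + suc l₂
    size = suc-injective (+-cancelˡ-≡ a _ _ (trans (sym b≡) (+-assoc a (suc l₁) (suc l₂))))
    l₁< : l₁ < suc l
    l₁< = subst (l₁ <_) (sym size) (m<m+n l₁ (s≤s z≤n))
    l₂< : l₂ < suc l
    l₂< = subst (suc l₂ ≤_) (sym size) (m≤n+m (suc l₂) l₁)

  earEncoding : ∀ a l → Chord a (a + suc l) → DyckEncoding l a (a + suc l)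
  earEncoding a l ab = dyckEncoding l a (a + suc l) (<-wellFounded l) refl (inj₂ ab)

≡ᵇ1-false : ∀ i → 2 ≤ i → (i ≡ᵇ 1) ≡ false
≡ᵇ1-false (suc zero) (s≤s ())
≡ᵇ1-false (suc (suc i)) _ = refl

module EarRemoval (k n′ r₀ : ℕ) (E : Graph) (tri : IsTriangulation (n′ + k + 2) E)
                  (s≤m : suc r₀ + suc k ≤ n′ + k + 2) (ear : T (inD (n′ + k + 2) E (suc r₀) (suc r₀ + suc k))) where

  open Triangulated tri using (nonCrossing; outdegUpTo; outdegUpTo-+; DyckEncoding; earEncoding)

  private
    r : ℕ
    r = suc r₀
    2≤1+r : 2 ≤ suc r
    2≤1+r = s≤s (s≤s z≤n)
    m m′ s : ℕ
    m = n′ + k + 2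
    m′ = n′ + 2
    s = r + suc k
    E′ : Graph
    E′ = removeEar k r E
    d d′ : ℕ → ℕ
    d = outdeg (n′ + k) E
    d′ = outdeg n′ E′

    arith₁ : ∀ n′ k → n′ + k + 2 ≡ n′ + 2 + k
    arith₁ = solve-∀

    m≡m′+k : m ≡ m′ + k
    m≡m′+k = arith₁ n′ k

    r<m′ : r < m′
    r<m′ = +-cancelʳ-≤ k (suc r) m′ (subst₂ _≤_ (+-suc r k) m≡m′+k s≤m)

    L : ℕ
    L = proj₁ (<⇒∃suc r<m′)

    m′≡r+1+L : m′ ≡ r + suc L
    m′≡r+1+L = proj₂ (<⇒∃suc r<m′)

    arith₂ : ∀ r L k → r + suc L + k ≡ r + k + suc L
    arith₂ = solve-∀

    m≡r+k+1+L : m ≡ r + k + suc L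
    m≡r+k+1+L = trans m≡m′+k (trans (cong (_+ k) m′≡r+1+L) (arith₂ r L k))

    arith₃ : ∀ r L k → r + k + suc L ≡ r + suc k + L
    arith₃ = solve-∀

    m≡s+L : m ≡ s + L
    m≡s+L = trans m≡r+k+1+L (arith₃ r L k)

  isDiag-removeEar : ∀ i j → ¬ (i ≡ r × j ≡ suc r) → isDiag m′ i j ≡ isDiag m (skip r k i) (skip r k j)
  isDiag-removeEar i j notEarSide with i ≤? r | j ≤? r
  ... | yes i≤r | yes j≤r =
    trans (isDiag-below m≡m′+k i j (≤-<-trans j≤r r<m′)) (cong₂ (isDiag m) (sym (skip-≤ k i≤r)) (sym (skip-≤ k j≤r)))
  ... | yes i≤r | no j≰r =
    trans (isDiag-stretch m≡m′+k i j i+2≤j) (cong₂ (isDiag m) (sym (skip-≤ k i≤r)) (sym (skip-> k r<j)))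
    where
    r<j : r < j
    r<j = ≰⇒> j≰r
    i+2≤j : i + 2 ≤ j
    i+2≤j with m≤n⇒m<n∨m≡n (≤-<-trans i≤r r<j)
    ... | inj₁ 1+i<j = subst (_≤ j) (+-comm 2 i) 1+i<j
    ... | inj₂ 1+i≡j = ⊥-elim (notEarSide (i≡r , trans (sym 1+i≡j) (cong suc i≡r)))
      where
      i≡r : i ≡ r
      i≡r = ≤-antisym i≤r (≤-pred (subst (r <_) (sym 1+i≡j) r<j))
  ... | no i≰r | yes j≤r =
    trans (isDiag-short m′ i j (≤-trans j≤r (≤-trans (<⇒≤ r<i) (n≤1+n i))))
          (sym (trans (cong₂ (isDiag m) (skip-> k r<i) (skip-≤ k j≤r))
                      (isDiag-short m (i + k) j (≤-trans j≤r (≤-trans (<⇒≤ r<i) (≤-trans (m≤m+n i k) (n≤1+n _)))))))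
    where
    r<i : r < i
    r<i = ≰⇒> i≰r
  ... | no i≰r | no j≰r =
    trans (isDiag-shift m≡m′+k i j (≤-trans 2≤1+r (≰⇒> i≰r)))
          (cong₂ (isDiag m) (sym (skip-> k (≰⇒> i≰r))) (sym (skip-> k (≰⇒> j≰r))))

  inD-removeEar : ∀ i j → ¬ (i ≡ r × j ≡ suc r) → inD m′ E′ i j ≡ inD m E (skip r k i) (skip r k j)
  inD-removeEar i j notEarSide = cong (_∧ E (skip r k i) (skip r k j)) (isDiag-removeEar i j notEarSide)

  outside-ear : ∀ i → i ≢ r → ∀ j → 1 ≤ j → j ≤ k → inD m E (skip r k i) (r + j) ≡ false
  outside-ear i i≢r j 1≤j j≤k with <-cmp i r
  ... | tri≈ _ i≡r _ = ⊥-elim (i≢r i≡r)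
  ... | tri< i<r _ _ = trans (cong (λ x → inD m E x (r + j)) (skip-≤ k (<⇒≤ i<r)))
    (¬T⇒≡false λ ij → nonCrossing r s i (r + j) ear ij (inj₂ (i<r , m<m+n r 1≤j , +-monoʳ-< r (s≤s j≤k))))
  ... | tri> _ _ r<i = trans (cong (λ x → inD m E x (r + j)) (skip-> k r<i))
    (inD-short m E (i + k) (r + j) (≤-trans (+-monoʳ-≤ r j≤k) (≤-trans (+-monoˡ-≤ k (<⇒≤ r<i)) (n≤1+n _))))

  ≡ᵇ1-skip : ∀ i → (i ≡ᵇ 1) ≡ (skip r k i ≡ᵇ 1)
  ≡ᵇ1-skip i with i ≤? r
  ... | yes i≤r = cong (_≡ᵇ 1) (sym (skip-≤ k i≤r))
  ... | no i≰r = trans (≡ᵇ1-false i 2≤i)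
    (sym (trans (cong (_≡ᵇ 1) (skip-> k (≰⇒> i≰r))) (≡ᵇ1-false (i + k) (≤-trans 2≤i (m≤m+n i k)))))
    where
    2≤i : 2 ≤ i
    2≤i = ≤-trans 2≤1+r (≰⇒> i≰r)

  outdeg-removeEar : ∀ i → i ≢ r → d′ i ≡ d (skip r k i)
  outdeg-removeEar i i≢r = cong₂ (λ x b → x + (if b then 1 else 0)) counts (≡ᵇ1-skip i)
    where
    open ≡-Reasoning
    i′ : ℕ
    i′ = skip r k i
    counts : countTo (inD m′ E′ i) m′ ≡ countTo (inD m E i′) m
    counts = begin
      countTo (inD m′ E′ i) m′                         ≡⟨ countTo-cong m′ (λ j _ _ → inD-removeEar i j (λ (i≡r , _) → i≢r i≡r)) ⟩
      countTo (λ j → inD m E i′ (skip r k j)) m′       ≡⟨ cong (countTo _) m′≡r+1+L ⟩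
      countTo (λ j → inD m E i′ (skip r k j)) (r + suc L) ≡⟨ countTo-skip (inD m E i′) r k (suc L) (outside-ear i i≢r) ⟩
      countTo (inD m E i′) (r + k + suc L)             ≡⟨ cong (countTo _) (sym m≡r+k+1+L) ⟩
      countTo (inD m E i′) m                           ∎

  outdeg-earVertex : d r ≡ d′ r + outdegUpTo s r
  outdeg-earVertex = begin
    countTo (inD m E r) m + e                                       ≡⟨ cong (λ t → countTo (inD m E r) t + e) m≡s+L ⟩
    countTo (inD m E r) (s + L) + e                                 ≡⟨ cong (_+ e) (countTo-+ _ s L) ⟩
    outdegUpTo s r + countTo (λ j → inD m E r (s + j)) L + e        ≡⟨ cong (λ x → outdegUpTo s r + x + e) (sym beyond) ⟩
    outdegUpTo s r + countTo (inD m′ E′ r) m′ + e                   ≡⟨ arith (outdegUpTo s r) _ e ⟩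
    countTo (inD m′ E′ r) m′ + e + outdegUpTo s r                   ∎
    where
    open ≡-Reasoning
    e : ℕ
    e = if r ≡ᵇ 1 then 1 else 0
    arith : ∀ a b c → a + b + c ≡ b + c + a
    arith = solve-∀
    arith′ : ∀ r j k → suc r + j + k ≡ r + suc k + j
    arith′ = solve-∀
    pointwise : ∀ j → 1 ≤ j → j ≤ L → inD m′ E′ r (suc r + j) ≡ inD m E r (s + j)
    pointwise j 1≤j _ = trans (inD-removeEar r (suc r + j) λ (_ , 1+r+j≡1+r) → <-irrefl (sym 1+r+j≡1+r) (s≤s (m<m+n r 1≤j)))
      (cong₂ (inD m E) (skip-≤ k ≤-refl) (trans (skip-> k (≤-trans (s≤s (m≤m+n r j)) ≤-refl)) (arith′ r j k)))
    beyond : countTo (inD m′ E′ r) m′ ≡ countTo (λ j → inD m E r (s + j)) L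
    beyond = begin
      countTo (inD m′ E′ r) m′                                                 ≡⟨ cong (countTo _) (trans m′≡r+1+L (+-suc r L)) ⟩
      countTo (inD m′ E′ r) (suc r + L)                                        ≡⟨ countTo-+ _ (suc r) L ⟩
      countTo (inD m′ E′ r) (suc r) + countTo (λ j → inD m′ E′ r (suc r + j)) L
        ≡⟨ cong₂ _+_ (countTo-zero (suc r) (λ j _ j≤1+r → inD-short m′ E′ r j j≤1+r)) (countTo-cong L pointwise) ⟩
      countTo (λ j → inD m E r (s + j)) L                                      ∎

  outdeg-earInterior : ∀ i → r < i → i < s → d i ≡ outdegUpTo s i
  outdeg-earInterior i r<i i<s = begin
    outdegUpTo m i + (if i ≡ᵇ 1 then 1 else 0)
      ≡⟨ cong₂ (λ t b → outdegUpTo t i + (if b then 1 else 0)) m≡s+L (≡ᵇ1-false i (≤-trans 2≤1+r r<i)) ⟩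
    outdegUpTo (s + L) i + 0                   ≡⟨ +-identityʳ _ ⟩
    outdegUpTo (s + L) i                       ≡⟨ outdegUpTo-+ i s L none ⟩
    outdegUpTo s i                             ∎
    where
    open ≡-Reasoning
    none : ∀ j → 1 ≤ j → j ≤ L → ¬ T (inD m E i (s + j))
    none j 1≤j _ ij = nonCrossing r s i (s + j) ear ij (inj₁ (r<i , i<s , m<m+n s 1≤j))

  private
    encoding : DyckEncoding k r s
    encoding = earEncoding r k ear
    D : List Bool
    D = proj₁ encoding
    balanced-D : Balanced D
    balanced-D = proj₁ (proj₂ encoding)
    length-D : length D ≡ k + k
    length-D = proj₁ (proj₂ (proj₂ encoding))
    bits-ear : bits (segment (outdegUpTo s) r (suc k)) ≡ D ++ false ∷ []
    bits-ear = proj₂ (proj₂ (proj₂ encoding))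
    A : List ℕ
    A = segment d 1 r₀

  segment-below-ear : segment d′ 1 r₀ ≡ A
  segment-below-ear = segment-cong 1 r₀ λ i _ i<r →
    trans (outdeg-removeEar i (λ i≡r → <-irrefl i≡r i<r)) (cong d (skip-≤ k (<⇒≤ i<r)))

  segment-above-ear : ∀ t → segment d′ (suc r) t ≡ segment d s t
  segment-above-ear t = begin
    segment d′ (suc r) t
      ≡⟨ segment-cong (suc r) t (λ i r<i _ → trans (outdeg-removeEar i (λ i≡r → <-irrefl (sym i≡r) r<i)) (cong d (skip-> k r<i))) ⟩
    segment (λ i → d (i + k)) (suc r) t ≡⟨ segment-shift d k (suc r) t ⟩
    segment d (suc r + k) t            ≡⟨ cong (λ a → segment d a t) (sym (+-suc r k)) ⟩
    segment d s t                      ∎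
    where open ≡-Reasoning

  bits-ear-segment : bits (segment d r (suc k)) ≡ replicate (d′ r) true ++ D ++ false ∷ []
  bits-ear-segment = begin
    bits (d r ∷ segment d (suc r) k)
      ≡⟨ cong₂ (λ x y → bits (x ∷ y)) outdeg-earVertex (segment-cong (suc r) k interior) ⟩
    bits ((d′ r + outdegUpTo s r) ∷ segment (outdegUpTo s) (suc r) k) ≡⟨ bits-+ (d′ r) (outdegUpTo s r) (segment (outdegUpTo s) (suc r) k) ⟩
    replicate (d′ r) true ++ bits (segment (outdegUpTo s) r (suc k))  ≡⟨ cong (replicate (d′ r) true ++_) bits-ear ⟩
    replicate (d′ r) true ++ D ++ false ∷ []                          ∎
    where
    open ≡-Reasoning
    interior : ∀ i → suc r ≤ i → i < suc r + k → d i ≡ outdegUpTo s i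
    interior i r<i i< = outdeg-earInterior i r<i (subst (i <_) (sym (+-suc r k)) i<)

  Decomposition : Set
  Decomposition = ∃₂ λ U V → bits (outdegSeq (n′ + k) E) ≡ U ++ D ++ V × bits (outdegSeq n′ E′) ≡ U ++ V

  decomposition-inner : r ≤ n′ → Decomposition
  decomposition-inner r≤n′ = bits A ++ R , false ∷ bits C , old , new
    where
    open ≡-Reasoning
    t : ℕ
    t = proj₁ (m≤n⇒∃[o]m+o≡n r≤n′)
    n′≡r₀+1+t : n′ ≡ r₀ + suc t
    n′≡r₀+1+t = trans (sym (proj₂ (m≤n⇒∃[o]m+o≡n r≤n′))) (sym (+-suc r₀ t))
    arith : ∀ r₀ t k → r₀ + suc t + k ≡ r₀ + (suc k + t)
    arith = solve-∀
    R : List Bool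
    R = replicate (d′ r) true
    C : List ℕ
    C = segment d s t
    regroup : ∀ (w x y z : List Bool) → w ++ (x ++ y) ++ z ≡ (w ++ x) ++ y ++ z
    regroup w x y z = trans (cong (w ++_) (++-assoc x y z)) (sym (++-assoc w x (y ++ z)))
    old : bits (outdegSeq (n′ + k) E) ≡ (bits A ++ R) ++ D ++ false ∷ bits C
    old = begin
      bits (outdegSeq (n′ + k) E)                       ≡⟨ cong bits (outdegSeq-segment (n′ + k) E) ⟩
      bits (segment d 1 (n′ + k))
        ≡⟨ cong (λ l → bits (segment d 1 l)) (trans (cong (_+ k) n′≡r₀+1+t) (arith r₀ t k)) ⟩
      bits (segment d 1 (r₀ + (suc k + t)))
        ≡⟨ cong bits (trans (segment-+ d 1 r₀ (suc k + t)) (cong (A ++_) (segment-+ d r (suc k) t))) ⟩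
      bits (A ++ segment d r (suc k) ++ C)              ≡⟨ trans (bits-++ A _) (cong (bits A ++_) (bits-++ (segment d r (suc k)) C)) ⟩
      bits A ++ bits (segment d r (suc k)) ++ bits C    ≡⟨ cong (λ x → bits A ++ x ++ bits C) bits-ear-segment ⟩
      bits A ++ (R ++ D ++ false ∷ []) ++ bits C        ≡⟨ regroup (bits A) R _ (bits C) ⟩
      (bits A ++ R) ++ (D ++ false ∷ []) ++ bits C      ≡⟨ cong ((bits A ++ R) ++_) (++-assoc D (false ∷ []) (bits C)) ⟩
      (bits A ++ R) ++ D ++ false ∷ bits C              ∎
    new : bits (outdegSeq n′ E′) ≡ (bits A ++ R) ++ false ∷ bits C
    new = begin
      bits (outdegSeq n′ E′)                            ≡⟨ cong bits (outdegSeq-segment n′ E′) ⟩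
      bits (segment d′ 1 n′)                            ≡⟨ cong (λ l → bits (segment d′ 1 l)) n′≡r₀+1+t ⟩
      bits (segment d′ 1 (r₀ + suc t))                  ≡⟨ cong bits (segment-+ d′ 1 r₀ (suc t)) ⟩
      bits (segment d′ 1 r₀ ++ d′ r ∷ segment d′ (suc r) t)
        ≡⟨ cong₂ (λ x y → bits (x ++ d′ r ∷ y)) segment-below-ear (segment-above-ear t) ⟩
      bits (A ++ d′ r ∷ C)                              ≡⟨ bits-++ A (d′ r ∷ C) ⟩
      bits A ++ (R ++ false ∷ []) ++ bits C             ≡⟨ regroup (bits A) R (false ∷ []) (bits C) ⟩
      (bits A ++ R) ++ false ∷ bits C                   ∎

  -- the ear ends at the last point, so p_r is no longer among the first n′ points of 𝒯′
  decomposition-last : r₀ ≡ n′ → 1 ≤ n′ → Decomposition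
  decomposition-last r₀≡n′ 1≤n′ = bits A , [] , old , new
    where
    open ≡-Reasoning
    arith : ∀ n k → n + k + 2 ≡ suc n + suc k
    arith = solve-∀
    m≡s : m ≡ s
    m≡s = trans (arith n′ k) (cong (λ x → suc x + suc k) (sym r₀≡n′))
    vertex : d r ≡ outdegUpTo s r
    vertex = trans (cong₂ (λ t b → outdegUpTo t r + (if b then 1 else 0)) m≡s
                          (≡ᵇ1-false r (s≤s (subst (1 ≤_) (sym r₀≡n′) 1≤n′))))
                   (+-identityʳ _)
    ear-tail : segment d r k ≡ segment (outdegUpTo s) r k
    ear-tail = segment-cong r k λ i r≤i i<r+k → case m≤n⇒m<n∨m≡n r≤i of λ where
      (inj₁ r<i) → outdeg-earInterior i r<i (≤-trans i<r+k (+-monoʳ-≤ r (n≤1+n k)))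
      (inj₂ refl) → vertex
    last-zero : outdegUpTo s (r + k) ≡ 0
    last-zero = countTo-zero s (λ j _ j≤s → inD-short m E (r + k) j (subst (j ≤_) (+-suc r k) j≤s))
    bits-tail : bits (segment (outdegUpTo s) r k) ≡ D
    bits-tail = ∷ʳ-injectiveˡ (bits (segment (outdegUpTo s) r k)) D (begin
      bits (segment (outdegUpTo s) r k) ++ bits (0 ∷ [])
        ≡⟨ cong (λ z → bits (segment (outdegUpTo s) r k) ++ bits (z ∷ [])) (sym last-zero) ⟩
      bits (segment (outdegUpTo s) r k) ++ bits (outdegUpTo s (r + k) ∷ [])
        ≡⟨ sym (trans (cong bits (segment-+ (outdegUpTo s) r k 1)) (bits-++ (segment (outdegUpTo s) r k) _)) ⟩
      bits (segment (outdegUpTo s) r (k + 1))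
        ≡⟨ cong (λ l → bits (segment (outdegUpTo s) r l)) (+-comm k 1) ⟩
      bits (segment (outdegUpTo s) r (suc k))                                ≡⟨ bits-ear ⟩
      D ++ false ∷ []                                                        ∎)
    old : bits (outdegSeq (n′ + k) E) ≡ bits A ++ D ++ []
    old = begin
      bits (outdegSeq (n′ + k) E)       ≡⟨ cong bits (outdegSeq-segment (n′ + k) E) ⟩
      bits (segment d 1 (n′ + k))       ≡⟨ cong (λ l → bits (segment d 1 (l + k))) (sym r₀≡n′) ⟩
      bits (segment d 1 (r₀ + k))       ≡⟨ cong bits (segment-+ d 1 r₀ k) ⟩
      bits (A ++ segment d r k)         ≡⟨ bits-++ A (segment d r k) ⟩
      bits A ++ bits (segment d r k)    ≡⟨ cong (λ x → bits A ++ bits x) ear-tail ⟩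
      bits A ++ bits (segment (outdegUpTo s) r k) ≡⟨ cong (bits A ++_) (trans bits-tail (sym (++-identityʳ D))) ⟩
      bits A ++ D ++ []                 ∎
    new : bits (outdegSeq n′ E′) ≡ bits A ++ []
    new = begin
      bits (outdegSeq n′ E′)            ≡⟨ cong bits (outdegSeq-segment n′ E′) ⟩
      bits (segment d′ 1 n′)            ≡⟨ cong (λ l → bits (segment d′ 1 l)) (sym r₀≡n′) ⟩
      bits (segment d′ 1 r₀)            ≡⟨ cong bits segment-below-ear ⟩
      bits A                            ≡⟨ sym (++-identityʳ (bits A)) ⟩
      bits A ++ []                      ∎

  decomposition : 1 ≤ n′ → Decomposition
  decomposition 1≤n′ with r ≤? n′
  ... | yes r≤n′ = decomposition-inner r≤n′
  ... | no r≰n′ = decomposition-last (≤-antisym (≤-pred r≤1+n′) (≤-pred (≰⇒> r≰n′))) 1≤n′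
    where
    r≤1+n′ : r ≤ suc n′
    r≤1+n′ = +-cancelʳ-≤ k r (suc n′) (≤-pred (subst₂ _≤_ (+-suc r k) (arith n′ k) s≤m))
      where
      arith : ∀ n k → n + k + 2 ≡ suc (suc n + k)
      arith = solve-∀

  kColorValid-removeEar : 1 ≤ n′ → KColorValid k (n′ + k) E → KColorValid k n′ E′
  kColorValid-removeEar 1≤n′ valid with decomposition 1≤n′
  ... | U , V , old , new =
    subst (λ w → All Monochromatic (scan 1 [] w)) (sym new)
      (scan-drop-balanced U V balanced-D length-D (subst (λ w → All Monochromatic (scan 1 [] w)) old valid))
    where open Colouring k

long-edge-chord : ∀ {m E i j} → suc i < j → ¬ (i ≡ 1 × j ≡ m) → IsEdge m E i j → T (inD m E i j)
long-edge-chord 1+i<j _ (inj₁ (inj₁ (_ , j≡1+i , _))) = ⊥-elim (<-irrefl (sym j≡1+i) 1+i<j)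
long-edge-chord _ notHull (inj₁ (inj₂ hull)) = ⊥-elim (notHull hull)
long-edge-chord _ _ (inj₂ chord) = chord

ear-not-hull : ∀ {p k r} → ¬ (r ≡ 1 × r + suc k ≡ suc p + k + 2)
ear-not-hull {p} {k} (refl , e) = 0≢1+n (+-cancelˡ-≡ (suc (suc k)) 0 (suc p) (trans (+-identityʳ _) (trans e (arith p k))))
  where
  arith : ∀ p k → suc p + k + 2 ≡ suc (suc k) + suc p
  arith = solve-∀

ear-removal : ∀ {k n r E} n′ → n ≡ n′ + k → 2 ≤ k →
              IsTriangulation (n + 2) E → KColorValid k n E →
              1 ≤ r → r + (k + 2) ∸ 1 ≤ n + 2 → IsEdge (n + 2) E r (r + (k + 2) ∸ 1) →
              KColorValid k n′ (removeEar k r E)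
ear-removal zero _ _ _ _ _ _ _ = []
ear-removal {k} {r = suc r₀} {E} (suc p) refl 2≤k tri valid (s≤s z≤n) s≤m edge =
  EarRemoval.kColorValid-removeEar k (suc p) r₀ E tri (subst (_≤ suc p + k + 2) ear-end s≤m) ear (s≤s z≤n) valid
  where
  arith : ∀ r₀ k → r₀ + (k + 2) ≡ suc r₀ + suc k
  arith = solve-∀
  ear-end : suc r₀ + (k + 2) ∸ 1 ≡ suc r₀ + suc k
  ear-end = arith r₀ k
  ear : T (inD (suc p + k + 2) E (suc r₀) (suc r₀ + suc k))
  ear = long-edge-chord {E = E} (≤-trans (≤-reflexive (+-comm 2 (suc r₀))) (+-monoʳ-≤ (suc r₀) (m≤n⇒m≤1+n 2≤k)))
                        ear-not-hull (subst (IsEdge (suc p + k + 2) E (suc r₀)) ear-end edge)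

lemma4 : (k n r : ℕ) (E : Graph) →
    2 ≤ k → 0 < n → k ∣ n →
    IsTriangulation (n + 2) E →
    KColorValid k n E →
    1 ≤ r → r + (k + 2) ∸ 1 ≤ n + 2 →
    IsEdge (n + 2) E r (r + (k + 2) ∸ 1) →
    KColorValid k (n ∸ k) (removeEar k r E)
lemma4 k n r E 2≤k 0<n k∣n =
  ear-removal (n ∸ k) (sym (m∸n+n≡m (∣⇒≤ {{>-nonZero 0<n}} k∣n))) 2≤k
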